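{- Let $\Gamma$ be a finite connected graph with vertex set $\mathcal{V}$ and Laplacian matrix $L$, fix a prime $p$, and for each integer $i \ge 0$ let $e_i$ denote the number of invariant factors (diagonal entries of the Smith normal form over $\mathbb{Z}$) of $L$ that are divisible by $p^i$ but not by $p^{i+1}$. Let $\eta$ be an eigenvalue of $L$ with multiplicity $m$, and assume that $\eta$ is an integer. Then: (1) if $p^i \mid \eta$, then $m \le 1 + \sum_{j \ge i} e_j$; (2) if $p^i \parallel \eta$ (i.e. $p^i \mid \eta$ and $p^{i+1} \nmid \eta$), then $m \le \sum_{0 \le j \le i} e_j$.
   Context: For a finite graph $\Gamma$ with vertices ordered, the Laplacian is $L = D - A$, where $A$ is the adjacency matrix and $D$ is the diagonal matrix of vertex degrees; $L$ is viewed as an integer matrix. The Smith normal form of $L$ is the unique diagonal matrix $\mathrm{diag}(s_1,\dots,s_{|\mathcal{V}|})$ with nonnegative integer entries satisfying $s_i \mid s_{i+1}$ such that $ULV$ equals it for some unimodular integer matrices $U,V$; the $s_i$ are the invariant factors. Note that the zero invariant factor is not counted in any $e_i$, and $e_0$ is the rank of $L$ over the field with $p$ elements. -}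

module Defs where

open import Data.Nat as ℕ using (ℕ; zero; suc; _^_)
open import Data.Nat.Divisibility using (_∣?_)
open import Data.Integer as ℤ using (ℤ; +_; -_)
open import Data.Rational as ℚ using (ℚ)
open import Data.Fin using (Fin; zero; suc; _≟_)
open import Data.Bool using (Bool; true; false; if_then_else_; _∧_; not)
open import Data.Product using (Σ; _×_; ∃)
open import Relation.Nullary using (¬_)
open import Relation.Nullary.Decidable using (⌊_⌋)
open import Relation.Binary.PropositionalEquality using (_≡_)

sumℕ : ∀ {n} → (Fin n → ℕ) → ℕ
sumℕ {zero}  f = 0
sumℕ {suc n} f = f zero ℕ.+ sumℕ (λ i → f (suc i))

sumℤ : ∀ {n} → (Fin n → ℤ) → ℤ
sumℤ {zero}  f = + 0
sumℤ {suc n} f = f zero ℤ.+ sumℤ (λ i → f (suc i))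

sumℚ : ∀ {n} → (Fin n → ℚ) → ℚ
sumℚ {zero}  f = ℚ.0ℚ
sumℚ {suc n} f = f zero ℚ.+ sumℚ (λ i → f (suc i))

count : ∀ {n} → (Fin n → Bool) → ℕ
count P = sumℕ (λ i → if P i then 1 else 0)

record Graph (n : ℕ) : Set where
  field
    adj       : Fin n → Fin n → Bool
    symmetric : ∀ u v → adj u v ≡ adj v u
    loopless  : ∀ u → adj u u ≡ false

open Graph public

data Walk {n} (G : Graph n) : Fin n → Fin n → Set where
  here : ∀ {u} → Walk G u u
  step : ∀ {u w v} → adj G u w ≡ true → Walk G w v → Walk G u v

Connected : ∀ {n} → Graph n → Set
Connected G = ∀ u v → Walk G u v

degree : ∀ {n} → Graph n → Fin n → ℕ
degree G u = count (adj G u)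

Matℤ : ℕ → Set
Matℤ n = Fin n → Fin n → ℤ

adjMat : ∀ {n} → Graph n → Matℤ n
adjMat G u v = if adj G u v then + 1 else + 0

degMat : ∀ {n} → Graph n → Matℤ n
degMat G u v = if ⌊ u ≟ v ⌋ then + degree G u else + 0

laplacian : ∀ {n} → Graph n → Matℤ n
laplacian G u v = degMat G u v ℤ.- adjMat G u v

_⊗_ : ∀ {n} → Matℤ n → Matℤ n → Matℤ n
(M ⊗ N) i j = sumℤ (λ k → M i k ℤ.* N k j)

idMat : ∀ {n} → Matℤ n
idMat i j = if ⌊ i ≟ j ⌋ then + 1 else + 0

diagMat : ∀ {n} → (Fin n → ℕ) → Matℤ n
diagMat s i j = if ⌊ i ≟ j ⌋ then + s i else + 0

Unimodular : ∀ {n} → Matℤ n → Set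
Unimodular {n} U = Σ (Matℤ n) λ W →
  (∀ i j → (U ⊗ W) i j ≡ idMat i j) × (∀ i j → (W ⊗ U) i j ≡ idMat i j)

IsSmithNormalForm : ∀ {n} → Matℤ n → (Fin n → ℕ) → Set
IsSmithNormalForm {n} M s =
  (∀ (i j : Fin n) → Data.Fin._<_ i j → s i Data.Nat.Divisibility.∣ s j) ×
  Σ (Matℤ n) λ U → Σ (Matℤ n) λ V →
    Unimodular U × Unimodular V × (∀ i j → ((U ⊗ M) ⊗ V) i j ≡ diagMat s i j)
  where import Data.Fin
        import Data.Nat.Divisibility

eCount : ∀ {n} → ℕ → (Fin n → ℕ) → ℕ → ℕ
eCount p s i = count (λ k → not ⌊ s k ℕ.≟ 0 ⌋
                          ∧ ⌊ p ^ i ∣? s k ⌋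
                          ∧ not ⌊ p ^ suc i ∣? s k ⌋)

eSumUpTo : ∀ {n} → ℕ → (Fin n → ℕ) → ℕ → ℕ
eSumUpTo p s i = sumℕ {suc i} (λ j → eCount p s (Data.Fin.toℕ j))
  where import Data.Fin

-- Σ_{j ≥ i} e_j.  Only finitely many e_j are nonzero: if s_k ≠ 0 and
-- p ≥ 2 then p^j ∤ s_k for j > s_k, so e_j = 0 for j > B := Σ_k s_k.
-- Hence the infinite sum equals the finite sum Σ_{j = i}^{i + B} e_j.
eSumFrom : ∀ {n} → ℕ → (Fin n → ℕ) → ℕ → ℕ
eSumFrom p s i = sumℕ {suc (sumℕ s)} (λ j → eCount p s (i ℕ.+ Data.Fin.toℕ j))
  where import Data.Fin

toℚ : ℤ → ℚ
toℚ z = z ℚ./ 1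

InEigenspace : ∀ {n} → Matℤ n → ℤ → (Fin n → ℚ) → Set
InEigenspace M η x = ∀ u → sumℚ (λ v → toℚ (M u v) ℚ.* x v) ≡ toℚ η ℚ.* x u

LinIndep : ∀ {n m} → (Fin m → Fin n → ℚ) → Set
LinIndep {n} {m} x = ∀ (c : Fin m → ℚ) →
  (∀ u → sumℚ (λ k → c k ℚ.* x k u) ≡ ℚ.0ℚ) → ∀ k → c k ≡ ℚ.0ℚ

-- η is an eigenvalue of M of multiplicity m (M symmetric here, so
-- geometric = algebraic multiplicity): the η-eigenspace has dimension m,
-- i.e. it contains m independent vectors but not m+1.
HasMultiplicity : ∀ {n} → Matℤ n → ℤ → ℕ → Set
HasMultiplicity {n} M η m =
  (Σ (Fin m → Fin n → ℚ) λ x → LinIndep x × (∀ k → InEigenspace M η (x k))) ×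
  (∀ (y : Fin (suc m) → Fin n → ℚ) → (∀ k → InEigenspace M η (y k)) → ¬ LinIndep y)

-- Write U L V = diag(s) with U, V unimodular. For an integer eigenvector y of L with eigenvalue η
-- this gives s_k (V⁻¹y)_k = η (Uy)_k for every k. If p^i ∣ η, then p divides (V⁻¹y)_k whenever
-- p^i ∤ s_k; so if V⁻¹y vanishes at every k with p^i ∣ s_k, then p divides V⁻¹y and hence y, and
-- y/p is again such a vector, which forces y = 0. Thus these coordinates of V⁻¹y determine the
-- eigenvector, and m is at most their number: the factors counted by the e_j with j ≥ i, plus
-- the zero factors, of which there is at most one because the kernel of the Laplacian of a
-- connected graph consists of constant vectors. Symmetrically, if p^(i+1) ∤ η, the coordinates
-- k of Uy with p^(i+1) ∤ s_k determine y, and these are counted by e_0 + ⋯ + e_i.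
-- Rational eigenvectors are first scaled to integral ones.

module Submission where

open import Defs
open import Data.Nat using (ℕ; suc; _^_; _≤_; _+_)
open import Data.Nat.Primality using (Prime)
open import Data.Integer using (ℤ; +_)
open import Data.Integer.Divisibility using (_∣_)
open import Data.Fin using (Fin)
open import Data.Product using (_×_)
open import Relation.Nullary using (¬_)

open import Data.Nat as ℕ using (zero; z≤n; s≤s; _<_)
import Data.Nat.Properties as ℕₚ
import Data.Nat.Divisibility as ℕ∣
open import Data.Nat.Primality using (euclidsLemma; prime⇒nonZero; prime⇒nonTrivial)
open import Data.Integer as ℤ using (0ℤ; 1ℤ)
import Data.Integer.Properties as ℤₚ
open import Data.Integer.Divisibility.Signed as ℤ∣ using (divides) renaming (_∣_ to _∣ₛ_)
open import Data.Integer.Tactic.RingSolver using (solve-∀)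
open import Algebra.Bundles using (CommutativeMonoid)
import Algebra.Properties.CommutativeSemigroup as CommSemigroupProperties
open import Data.Rational as ℚ using (ℚ; mkℚ)
import Data.Rational.Properties as ℚₚ
import Data.Rational.Unnormalised as ℚᵘ
import Data.Rational.Unnormalised.Properties as ℚᵘₚ
open import Data.Fin as Fin using (zero; suc; punchIn)
import Data.Fin.Properties as Finₚ
open import Data.Vec.Functional using (tail; insertAt)
open import Data.Vec.Functional.Properties using (insertAt-lookup; insertAt-punchIn)
open import Data.Bool using (Bool; true; false; T; not; _∧_; if_then_else_)
open import Data.Bool.Properties using (T-∧)
open import Data.Product using (∃; _,_; proj₁; proj₂)
open import Data.Sum using (_⊎_; inj₁; inj₂)
open import Function using (_∘_; case_of_; Equivalence)
open import Relation.Nullary using (yes; no; contradiction; T?; decidable-stable)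
open import Relation.Nullary.Decidable using (⌊_⌋; toWitness; fromWitness; toWitnessFalse; fromWitnessFalse)
open import Relation.Unary using (Decidable)
open import Relation.Binary.PropositionalEquality
open ≡-Reasoning

private
  module ℕ+ = CommSemigroupProperties ℕₚ.+-commutativeSemigroup
  module ℤ+ = CommSemigroupProperties ℤₚ.+-commutativeSemigroup
  module ℤ* = CommSemigroupProperties ℤₚ.*-commutativeSemigroup
  module ℚ* = CommSemigroupProperties (CommutativeMonoid.commutativeSemigroup ℚₚ.*-1-commutativeMonoid)

Vecℤ : ℕ → Set
Vecℤ n = Fin n → ℤ

sumℤ-cong : ∀ {n} {f g : Vecℤ n} → (∀ i → f i ≡ g i) → sumℤ f ≡ sumℤ g
sumℤ-cong {zero}  f≗g = refl
sumℤ-cong {suc n} f≗g = cong₂ ℤ._+_ (f≗g zero) (sumℤ-cong (f≗g ∘ suc))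

sumℤ-zero : ∀ {n} (f : Vecℤ n) → (∀ i → f i ≡ 0ℤ) → sumℤ f ≡ 0ℤ
sumℤ-zero {zero}  f f≗0 = refl
sumℤ-zero {suc n} f f≗0 = cong₂ ℤ._+_ (f≗0 zero) (sumℤ-zero (tail f) (f≗0 ∘ suc))

sumℤ-+ : ∀ {n} (f g : Vecℤ n) → sumℤ (λ i → f i ℤ.+ g i) ≡ sumℤ f ℤ.+ sumℤ g
sumℤ-+ {zero}  f g = refl
sumℤ-+ {suc n} f g = begin
  f₀ ℤ.+ g₀ ℤ.+ sumℤ (λ i → f (suc i) ℤ.+ g (suc i))  ≡⟨ cong (ℤ._+_ (f₀ ℤ.+ g₀)) (sumℤ-+ (tail f) (tail g)) ⟩
  f₀ ℤ.+ g₀ ℤ.+ (sumℤ (tail f) ℤ.+ sumℤ (tail g))      ≡⟨ ℤ+.interchange f₀ g₀ _ _ ⟩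
  f₀ ℤ.+ sumℤ (tail f) ℤ.+ (g₀ ℤ.+ sumℤ (tail g))      ∎
  where
  f₀ g₀ : ℤ
  f₀ = f zero
  g₀ = g zero

sumℤ-- : ∀ {n} (f g : Vecℤ n) → sumℤ (λ i → f i ℤ.- g i) ≡ sumℤ f ℤ.- sumℤ g
sumℤ-- {zero}  f g = refl
sumℤ-- {suc n} f g = begin
  f₀ ℤ.- g₀ ℤ.+ sumℤ (λ i → f (suc i) ℤ.- g (suc i))  ≡⟨ cong (ℤ._+_ (f₀ ℤ.- g₀)) (sumℤ-- (tail f) (tail g)) ⟩
  f₀ ℤ.- g₀ ℤ.+ (sumℤ (tail f) ℤ.- sumℤ (tail g))      ≡⟨ interchange f₀ g₀ _ _ ⟩
  f₀ ℤ.+ sumℤ (tail f) ℤ.- (g₀ ℤ.+ sumℤ (tail g))      ∎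
  where
  f₀ g₀ : ℤ
  f₀ = f zero
  g₀ = g zero
  interchange : ∀ a b c d → a ℤ.- b ℤ.+ (c ℤ.- d) ≡ a ℤ.+ c ℤ.- (b ℤ.+ d)
  interchange = solve-∀

sumℤ-*ˡ : ∀ {n} (c : ℤ) (f : Vecℤ n) → sumℤ (λ i → c ℤ.* f i) ≡ c ℤ.* sumℤ f
sumℤ-*ˡ {zero}  c f = sym (ℤₚ.*-zeroʳ c)
sumℤ-*ˡ {suc n} c f = trans (cong (ℤ._+_ (c ℤ.* f zero)) (sumℤ-*ˡ c (tail f)))
                            (sym (ℤₚ.*-distribˡ-+ c (f zero) _))

sumℤ-*ʳ : ∀ {n} (c : ℤ) (f : Vecℤ n) → sumℤ (λ i → f i ℤ.* c) ≡ sumℤ f ℤ.* c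
sumℤ-*ʳ c f = begin
  sumℤ (λ i → f i ℤ.* c)  ≡⟨ sumℤ-cong (λ i → ℤₚ.*-comm (f i) c) ⟩
  sumℤ (λ i → c ℤ.* f i)  ≡⟨ sumℤ-*ˡ c f ⟩
  c ℤ.* sumℤ f            ≡⟨ ℤₚ.*-comm c (sumℤ f) ⟩
  sumℤ f ℤ.* c            ∎

sumℤ-comm : ∀ {m n} (f : Fin m → Fin n → ℤ) →
  sumℤ (λ i → sumℤ (f i)) ≡ sumℤ (λ j → sumℤ (λ i → f i j))
sumℤ-comm {zero} {n} f = sym (sumℤ-zero {n} _ (λ j → refl))
sumℤ-comm {suc m} f = begin
  sumℤ (f zero) ℤ.+ sumℤ (λ i → sumℤ (f (suc i)))
    ≡⟨ cong (ℤ._+_ (sumℤ (f zero))) (sumℤ-comm (tail f)) ⟩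
  sumℤ (f zero) ℤ.+ sumℤ (λ j → sumℤ (λ i → f (suc i) j))
    ≡⟨ sumℤ-+ (f zero) _ ⟨
  sumℤ (λ j → sumℤ (λ i → f i j))  ∎

sumℤ-δ : ∀ {n} (i : Fin n) (f : Vecℤ n) → sumℤ (λ j → if ⌊ i Fin.≟ j ⌋ then f j else 0ℤ) ≡ f i
sumℤ-δ {suc n} zero f = trans (cong (ℤ._+_ (f zero)) (sumℤ-zero {n} _ (λ j → refl))) (ℤₚ.+-identityʳ _)
sumℤ-δ {suc n} (suc i) f = trans (ℤₚ.+-identityˡ _) (trans (sumℤ-cong δ-suc) (sumℤ-δ i (tail f)))
  where
  δ-suc : ∀ j → (if ⌊ suc i Fin.≟ suc j ⌋ then f (suc j) else 0ℤ)
              ≡ (if ⌊ i Fin.≟ j ⌋ then f (suc j) else 0ℤ)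
  δ-suc j with i Fin.≟ j
  ... | yes _ = refl
  ... | no  _ = refl

sumℤ-punchIn : ∀ {m} (k : Fin (suc m)) (f : Vecℤ (suc m)) → sumℤ f ≡ f k ℤ.+ sumℤ (f ∘ punchIn k)
sumℤ-punchIn zero f = refl
sumℤ-punchIn {suc m} (suc k) f = begin
  f₀ ℤ.+ sumℤ (tail f)                              ≡⟨ cong (ℤ._+_ f₀) (sumℤ-punchIn k (tail f)) ⟩
  f₀ ℤ.+ (f (suc k) ℤ.+ sumℤ (tail f ∘ punchIn k))  ≡⟨ ℤ+.x∙yz≈y∙xz f₀ (f (suc k)) _ ⟩
  f (suc k) ℤ.+ (f₀ ℤ.+ sumℤ (tail f ∘ punchIn k))  ∎
  where
  f₀ : ℤ
  f₀ = f zero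

sumℤ-nonneg : ∀ {n} (f : Vecℤ n) → (∀ i → 0ℤ ℤ.≤ f i) → 0ℤ ℤ.≤ sumℤ f
sumℤ-nonneg {zero}  f f≥0 = ℤₚ.≤-refl
sumℤ-nonneg {suc n} f f≥0 = ℤₚ.+-mono-≤ (f≥0 zero) (sumℤ-nonneg (tail f) (f≥0 ∘ suc))

nonneg-+-zero : ∀ {a b} → 0ℤ ℤ.≤ a → 0ℤ ℤ.≤ b → a ℤ.+ b ≡ 0ℤ → a ≡ 0ℤ × b ≡ 0ℤ
nonneg-+-zero (ℤ.+≤+ {n = m} _) (ℤ.+≤+ {n = n} _) m+n≡0 =
  cong +_ (ℕₚ.m+n≡0⇒m≡0 m (ℤₚ.+-injective m+n≡0)) , cong +_ (ℕₚ.m+n≡0⇒n≡0 m (ℤₚ.+-injective m+n≡0))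

sumℤ-nonneg-zero : ∀ {n} (f : Vecℤ n) → (∀ i → 0ℤ ℤ.≤ f i) → sumℤ f ≡ 0ℤ → ∀ i → f i ≡ 0ℤ
sumℤ-nonneg-zero {suc n} f f≥0 Σf≡0 with nonneg-+-zero (f≥0 zero) (sumℤ-nonneg (tail f) (f≥0 ∘ suc)) Σf≡0
... | f₀≡0 , Σtail≡0 = λ where
  zero    → f₀≡0
  (suc i) → sumℤ-nonneg-zero (tail f) (f≥0 ∘ suc) Σtail≡0 i

sumℕ-mono : ∀ {n} (f g : Fin n → ℕ) → (∀ i → f i ≤ g i) → sumℕ f ≤ sumℕ g
sumℕ-mono {zero}  f g f≤g = z≤n
sumℕ-mono {suc n} f g f≤g = ℕₚ.+-mono-≤ (f≤g zero) (sumℕ-mono (tail f) (tail g) (f≤g ∘ suc))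

term≤sumℕ : ∀ {n} (f : Fin n → ℕ) i → f i ≤ sumℕ f
term≤sumℕ f zero    = ℕₚ.m≤m+n (f zero) _
term≤sumℕ f (suc i) = ℕₚ.≤-trans (term≤sumℕ (tail f) i) (ℕₚ.m≤n+m _ (f zero))

sumℕ-+ : ∀ {n} (f g : Fin n → ℕ) → sumℕ (λ i → f i + g i) ≡ sumℕ f + sumℕ g
sumℕ-+ {zero}  f g = refl
sumℕ-+ {suc n} f g = trans (cong (_+_ (f zero + g zero)) (sumℕ-+ (tail f) (tail g)))
                           (ℕ+.interchange (f zero) (g zero) _ _)

sumℕ-zero : ∀ {n} (f : Fin n → ℕ) → (∀ i → f i ≡ 0) → sumℕ f ≡ 0
sumℕ-zero {zero}  f f≗0 = refl
sumℕ-zero {suc n} f f≗0 = cong₂ _+_ (f≗0 zero) (sumℕ-zero (tail f) (f≗0 ∘ suc))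

sumℕ-comm : ∀ {m n} (f : Fin m → Fin n → ℕ) →
  sumℕ (λ i → sumℕ (f i)) ≡ sumℕ (λ j → sumℕ (λ i → f i j))
sumℕ-comm {zero}  {n} f = sym (sumℕ-zero {n} (λ j → 0) (λ j → refl))
sumℕ-comm {suc m} f = trans (cong (_+_ (sumℕ (f zero))) (sumℕ-comm (tail f))) (sym (sumℕ-+ (f zero) _))

+sumℕ : ∀ {n} (f : Fin n → ℕ) → + sumℕ f ≡ sumℤ (λ i → + f i)
+sumℕ {zero}  f = refl
+sumℕ {suc n} f = trans (ℤₚ.pos-+ (f zero) _) (cong (ℤ._+_ (+ f zero)) (+sumℕ (tail f)))

𝟙 : Bool → ℕ
𝟙 b = if b then 1 else 0

𝟙-≤ : ∀ {b n} → (T b → 1 ≤ n) → 𝟙 b ≤ n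
𝟙-≤ {false} _   = z≤n
𝟙-≤ {true}  1≤n = 1≤n _

T⇒1≤𝟙 : ∀ {b} → T b → 1 ≤ 𝟙 b
T⇒1≤𝟙 {true} _ = s≤s z≤n

count-≤-union : ∀ {n} (S A B : Fin n → Bool) → (∀ k → T (S k) → T (A k) ⊎ T (B k)) →
  count S ≤ count A + count B
count-≤-union S A B S⊆A∪B = ℕₚ.≤-trans (sumℕ-mono _ _ pointwise) (ℕₚ.≤-reflexive (sumℕ-+ (𝟙 ∘ A) (𝟙 ∘ B)))
  where
  pointwise : ∀ k → 𝟙 (S k) ≤ 𝟙 (A k) + 𝟙 (B k)
  pointwise k = 𝟙-≤ λ Sk → case S⊆A∪B k Sk of λ where
    (inj₁ Ak) → ℕₚ.≤-trans (T⇒1≤𝟙 Ak) (ℕₚ.m≤m+n _ _)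
    (inj₂ Bk) → ℕₚ.≤-trans (T⇒1≤𝟙 Bk) (ℕₚ.m≤n+m _ _)

count-≤-cover : ∀ {n J} (S : Fin n → Bool) (E : Fin J → Fin n → Bool) →
  (∀ k → T (S k) → ∃ λ j → T (E j k)) → count S ≤ sumℕ (λ j → count (E j))
count-≤-cover S E S⊆⋃E = ℕₚ.≤-trans (sumℕ-mono _ _ pointwise) (ℕₚ.≤-reflexive (sumℕ-comm (λ k j → 𝟙 (E j k))))
  where
  pointwise : ∀ k → 𝟙 (S k) ≤ sumℕ (λ j → 𝟙 (E j k))
  pointwise k = 𝟙-≤ λ Sk → let (j , Ejk) = S⊆⋃E k Sk in ℕₚ.≤-trans (T⇒1≤𝟙 Ejk) (term≤sumℕ _ j)

count-≤-1 : ∀ {n} (S : Fin n → Bool) → (∀ k k′ → T (S k) → T (S k′) → k ≡ k′) → count S ≤ 1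
count-≤-1 {zero}  S unique = z≤n
count-≤-1 {suc n} S unique with S zero in S₀
... | true  = s≤s (ℕₚ.≤-reflexive (sumℕ-zero _ (λ j → tail-false j (S (suc j)) refl)))
  where
  tail-false : ∀ j b → S (suc j) ≡ b → 𝟙 b ≡ 0
  tail-false j false _  = refl
  tail-false j true  Sj with () ← unique zero (suc j) (subst T (sym S₀) _) (subst T (sym Sj) _)
... | false = count-≤-1 (tail S) (λ k k′ Sk Sk′ → Finₚ.suc-injective (unique (suc k) (suc k′) Sk Sk′))

count-head : ∀ {n} (S : Fin (suc n) → Bool) → T (S zero) → count S ≡ suc (count (tail S))
count-head S S₀ with S zero
... | true = refl

count-tail-≤ : ∀ {n} (S : Fin (suc n) → Bool) → count (tail S) ≤ count S
count-tail-≤ S = ℕₚ.m≤n+m _ (𝟙 (S zero))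

divisibleᵇ : ℕ → ℕ → Bool
divisibleᵇ d a = ⌊ d ℕ∣.∣? a ⌋

isZeroᵇ : ℕ → Bool
isZeroᵇ a = ⌊ a ℕ.≟ 0 ⌋

∣⇒divisibleᵇ : ∀ {d a} → d ℕ∣.∣ a → T (divisibleᵇ d a)
∣⇒divisibleᵇ {d} {a} = fromWitness {a? = d ℕ∣.∣? a}

divisibleᵇ⇒∣ : ∀ {d a} → T (divisibleᵇ d a) → d ℕ∣.∣ a
divisibleᵇ⇒∣ {d} {a} = toWitness {a? = d ℕ∣.∣? a}

∤⇒not-divisibleᵇ : ∀ {d a} → ¬ d ℕ∣.∣ a → T (not (divisibleᵇ d a))
∤⇒not-divisibleᵇ {d} {a} = fromWitnessFalse {a? = d ℕ∣.∣? a}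

not-divisibleᵇ⇒∤ : ∀ {d a} → T (not (divisibleᵇ d a)) → ¬ d ℕ∣.∣ a
not-divisibleᵇ⇒∤ {d} {a} = toWitnessFalse {a? = d ℕ∣.∣? a}

isZeroᵇ⇒≡0 : ∀ {a} → T (isZeroᵇ a) → a ≡ 0
isZeroᵇ⇒≡0 {a} = toWitness {a? = a ℕ.≟ 0}

≢0⇒not-isZeroᵇ : ∀ {a} → a ≢ 0 → T (not (isZeroᵇ a))
≢0⇒not-isZeroᵇ {a} = fromWitnessFalse {a? = a ℕ.≟ 0}

not-isZeroᵇ⇒≢0 : ∀ {a} → T (not (isZeroᵇ a)) → a ≢ 0
not-isZeroᵇ⇒≢0 {a} = toWitnessFalse {a? = a ℕ.≟ 0}

if-T : ∀ {b} {x y : ℤ} → T b → (if b then x else y) ≡ x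
if-T {true} _ = refl

if-¬T : ∀ {b} {x y : ℤ} → ¬ T b → (if b then x else y) ≡ y
if-¬T {false} _  = refl
if-¬T {true}  ¬b = contradiction _ ¬b

if-* : ∀ b (c x : ℤ) → (if b then c else 0ℤ) ℤ.* x ≡ (if b then c ℤ.* x else 0ℤ)
if-* true  c x = refl
if-* false c x = refl

infixr 7 _·_

_·_ : ∀ {n} → Matℤ n → Vecℤ n → Vecℤ n
(M · v) i = sumℤ (λ j → M i j ℤ.* v j)

·-congˡ : ∀ {n} {M N : Matℤ n} (v : Vecℤ n) → (∀ i j → M i j ≡ N i j) → ∀ i → (M · v) i ≡ (N · v) i
·-congˡ v M≗N i = sumℤ-cong (λ j → cong (ℤ._* v j) (M≗N i j))

·-congʳ : ∀ {n} (M : Matℤ n) {v w : Vecℤ n} → (∀ i → v i ≡ w i) → ∀ i → (M · v) i ≡ (M · w) i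
·-congʳ M v≗w i = sumℤ-cong (λ j → cong (M i j ℤ.*_) (v≗w j))

⊗-· : ∀ {n} (M N : Matℤ n) (v : Vecℤ n) i → ((M ⊗ N) · v) i ≡ (M · N · v) i
⊗-· M N v i = begin
  sumℤ (λ j → sumℤ (λ k → M i k ℤ.* N k j) ℤ.* v j)
    ≡⟨ sumℤ-cong (λ j → sym (sumℤ-*ʳ (v j) (λ k → M i k ℤ.* N k j))) ⟩
  sumℤ (λ j → sumℤ (λ k → M i k ℤ.* N k j ℤ.* v j))
    ≡⟨ sumℤ-comm (λ j k → M i k ℤ.* N k j ℤ.* v j) ⟩
  sumℤ (λ k → sumℤ (λ j → M i k ℤ.* N k j ℤ.* v j))
    ≡⟨ sumℤ-cong (λ k → sumℤ-cong (λ j → ℤₚ.*-assoc (M i k) (N k j) (v j))) ⟩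
  sumℤ (λ k → sumℤ (λ j → M i k ℤ.* (N k j ℤ.* v j)))
    ≡⟨ sumℤ-cong (λ k → sumℤ-*ˡ (M i k) (λ j → N k j ℤ.* v j)) ⟩
  sumℤ (λ k → M i k ℤ.* sumℤ (λ j → N k j ℤ.* v j))  ∎

diagMat-· : ∀ {n} (s : Fin n → ℕ) (v : Vecℤ n) i → (diagMat s · v) i ≡ + s i ℤ.* v i
diagMat-· s v i = trans (sumℤ-cong (λ j → if-* _ (+ s i) (v j))) (sumℤ-δ i (λ j → + s i ℤ.* v j))

idMat-· : ∀ {n} (v : Vecℤ n) i → (idMat · v) i ≡ v i
idMat-· v i = trans (diagMat-· (λ _ → 1) v i) (ℤₚ.*-identityˡ (v i))

·-*ʳ : ∀ {n} (M : Matℤ n) (c : ℤ) (v : Vecℤ n) i → (M · (λ j → v j ℤ.* c)) i ≡ (M · v) i ℤ.* c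
·-*ʳ M c v i = trans (sumℤ-cong (λ j → sym (ℤₚ.*-assoc (M i j) (v j) c))) (sumℤ-*ʳ c (λ j → M i j ℤ.* v j))

·-*ˡ : ∀ {n} (M : Matℤ n) (c : ℤ) (v : Vecℤ n) i → (M · (λ j → c ℤ.* v j)) i ≡ c ℤ.* (M · v) i
·-*ˡ M c v i = trans (sumℤ-cong (λ j → ℤ*.x∙yz≈y∙xz (M i j) c (v j))) (sumℤ-*ˡ c (λ j → M i j ℤ.* v j))

·-zero : ∀ {n} (M : Matℤ n) {v : Vecℤ n} → (∀ j → v j ≡ 0ℤ) → ∀ i → (M · v) i ≡ 0ℤ
·-zero M v≗0 i = sumℤ-zero _ (λ j → trans (cong (M i j ℤ.*_) (v≗0 j)) (ℤₚ.*-zeroʳ (M i j)))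

·-lincomb : ∀ {n m} (M : Matℤ n) (c : Fin m → ℤ) (z : Fin m → Vecℤ n) i →
  (M · (λ j → sumℤ (λ k → c k ℤ.* z k j))) i ≡ sumℤ (λ k → c k ℤ.* (M · z k) i)
·-lincomb M c z i = begin
  sumℤ (λ j → M i j ℤ.* sumℤ (λ k → c k ℤ.* z k j))
    ≡⟨ sumℤ-cong (λ j → sym (sumℤ-*ˡ (M i j) (λ k → c k ℤ.* z k j))) ⟩
  sumℤ (λ j → sumℤ (λ k → M i j ℤ.* (c k ℤ.* z k j)))
    ≡⟨ sumℤ-comm (λ j k → M i j ℤ.* (c k ℤ.* z k j)) ⟩
  sumℤ (λ k → sumℤ (λ j → M i j ℤ.* (c k ℤ.* z k j)))
    ≡⟨ sumℤ-cong (λ k → sumℤ-cong (λ j → ℤ*.x∙yz≈y∙xz (M i j) (c k) (z k j))) ⟩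
  sumℤ (λ k → sumℤ (λ j → c k ℤ.* (M i j ℤ.* z k j)))
    ≡⟨ sumℤ-cong (λ k → sumℤ-*ˡ (c k) (λ j → M i j ℤ.* z k j)) ⟩
  sumℤ (λ k → c k ℤ.* (M · z k) i)  ∎

∣ₛ-sumℤ : ∀ {n} (d : ℤ) (f : Vecℤ n) → (∀ i → d ∣ₛ f i) → d ∣ₛ sumℤ f
∣ₛ-sumℤ {zero}  d f d∣f = divides 0ℤ (sym (ℤₚ.*-zeroˡ d))
∣ₛ-sumℤ {suc n} d f d∣f = ℤ∣.∣m∣n⇒∣m+n (d∣f zero) (∣ₛ-sumℤ d (tail f) (d∣f ∘ suc))

∣ₛ-· : ∀ {n} (d : ℤ) (M : Matℤ n) (v : Vecℤ n) → (∀ j → d ∣ₛ v j) → ∀ i → d ∣ₛ (M · v) i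
∣ₛ-· d M v d∣v i = ∣ₛ-sumℤ d _ (λ j → ℤ∣.∣n⇒∣m*n (M i j) (d∣v j))

·-inverse : ∀ {n} (M N : Matℤ n) → (∀ i j → (M ⊗ N) i j ≡ idMat i j) → ∀ v i → (M · N · v) i ≡ v i
·-inverse M N MN≡I v i = trans (sym (⊗-· M N v i)) (trans (·-congˡ v MN≡I i) (idMat-· v i))

idMat-diag : ∀ {n} (k : Fin n) → idMat k k ≡ 1ℤ
idMat-diag k = if-T (fromWitness {a? = k Fin.≟ k} refl)

idMat-off-diag : ∀ {n} {j k : Fin n} → j ≢ k → idMat j k ≡ 0ℤ
idMat-off-diag {j = j} {k} j≢k = if-¬T (j≢k ∘ toWitness {a? = j Fin.≟ k})

LinIndepℤ : ∀ {n m} → (Fin m → Vecℤ n) → Set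
LinIndepℤ {n} {m} f = ∀ (c : Fin m → ℤ) → (∀ u → sumℤ (λ k → c k ℤ.* f k u) ≡ 0ℤ) → ∀ k → c k ≡ 0ℤ

SupportedOn : ∀ {n m} → (Fin n → Bool) → (Fin m → Vecℤ n) → Set
SupportedOn S f = ∀ k u → ¬ T (S u) → f k u ≡ 0ℤ

linIndep-tail : ∀ {n m} (f : Fin m → Vecℤ (suc n)) → LinIndepℤ f → (∀ k → f k zero ≡ 0ℤ) →
  LinIndepℤ (tail ∘ f)
linIndep-tail f indep f₀≡0 c Σ≡0 = indep c λ where
  zero    → sumℤ-zero _ (λ k → trans (cong (c k ℤ.*_) (f₀≡0 k)) (ℤₚ.*-zeroʳ (c k)))
  (suc u) → Σ≡0 u

module Elimination {n m} (f : Fin (suc m) → Vecℤ n) (k₀ : Fin (suc m)) (u₀ : Fin n) where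

  pivot : ℤ
  pivot = f k₀ u₀

  eliminate : Fin m → Vecℤ n
  eliminate j u = pivot ℤ.* f (punchIn k₀ j) u ℤ.- f (punchIn k₀ j) u₀ ℤ.* f k₀ u

  eliminate-pivot : ∀ j → eliminate j u₀ ≡ 0ℤ
  eliminate-pivot j = cross-cancel pivot (f (punchIn k₀ j) u₀)
    where
    cross-cancel : ∀ a b → a ℤ.* b ℤ.- b ℤ.* a ≡ 0ℤ
    cross-cancel = solve-∀

  supportedOn-eliminate : ∀ S → SupportedOn S f → SupportedOn S eliminate
  supportedOn-eliminate S supp j u ¬Su
    rewrite supp (punchIn k₀ j) u ¬Su | supp k₀ u ¬Su = annihilate pivot (f (punchIn k₀ j) u₀)
    where
    annihilate : ∀ a b → a ℤ.* 0ℤ ℤ.- b ℤ.* 0ℤ ≡ 0ℤ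
    annihilate = solve-∀

  linIndep-eliminate : LinIndepℤ f → pivot ≢ 0ℤ → LinIndepℤ eliminate
  linIndep-eliminate indep pivot≢0 c Σ≡0 j with ℤₚ.i*j≡0⇒i≡0∨j≡0 (c j) cⱼpivot≡0
    where
    C : ℤ
    C = sumℤ (λ j → c j ℤ.* f (punchIn k₀ j) u₀)

    d : Fin (suc m) → ℤ
    d = insertAt (λ j → c j ℤ.* pivot) k₀ (ℤ.- C)

    Σd≡0 : ∀ u → sumℤ (λ k → d k ℤ.* f k u) ≡ 0ℤ
    Σd≡0 u = begin
      sumℤ (λ k → d k ℤ.* f k u)
        ≡⟨ sumℤ-punchIn k₀ (λ k → d k ℤ.* f k u) ⟩
      d k₀ ℤ.* f k₀ u ℤ.+ sumℤ (λ j → d (punchIn k₀ j) ℤ.* f (punchIn k₀ j) u)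
        ≡⟨ cong₂ ℤ._+_ (cong (ℤ._* f k₀ u) (insertAt-lookup _ k₀ _))
                       (sumℤ-cong (λ j → cong (ℤ._* f (punchIn k₀ j) u) (insertAt-punchIn _ k₀ _ j))) ⟩
      ℤ.- C ℤ.* f k₀ u ℤ.+ A
        ≡⟨ reorder C (f k₀ u) A ⟩
      A ℤ.- C ℤ.* f k₀ u
        ≡⟨ cong (ℤ._-_ A) (sumℤ-*ʳ (f k₀ u) (λ j → c j ℤ.* f (punchIn k₀ j) u₀)) ⟨
      A ℤ.- sumℤ (λ j → c j ℤ.* f (punchIn k₀ j) u₀ ℤ.* f k₀ u)
        ≡⟨ sumℤ-- (λ j → c j ℤ.* pivot ℤ.* f (punchIn k₀ j) u) (λ j → c j ℤ.* f (punchIn k₀ j) u₀ ℤ.* f k₀ u) ⟨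
      sumℤ (λ j → c j ℤ.* pivot ℤ.* f (punchIn k₀ j) u ℤ.- c j ℤ.* f (punchIn k₀ j) u₀ ℤ.* f k₀ u)
        ≡⟨ sumℤ-cong (λ j → distrib (c j) pivot (f (punchIn k₀ j) u) (f (punchIn k₀ j) u₀) (f k₀ u)) ⟩
      sumℤ (λ j → c j ℤ.* eliminate j u)
        ≡⟨ Σ≡0 u ⟩
      0ℤ ∎
      where
      A : ℤ
      A = sumℤ (λ j → c j ℤ.* pivot ℤ.* f (punchIn k₀ j) u)
      reorder : ∀ C x A → ℤ.- C ℤ.* x ℤ.+ A ≡ A ℤ.- C ℤ.* x
      reorder = solve-∀
      distrib : ∀ c a x y z → c ℤ.* a ℤ.* x ℤ.- c ℤ.* y ℤ.* z ≡ c ℤ.* (a ℤ.* x ℤ.- y ℤ.* z)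
      distrib = solve-∀

    cⱼpivot≡0 : c j ℤ.* pivot ≡ 0ℤ
    cⱼpivot≡0 = trans (sym (insertAt-punchIn _ k₀ _ j)) (indep d Σd≡0 (punchIn k₀ j))
  ... | inj₁ cⱼ≡0     = cⱼ≡0
  ... | inj₂ pivot≡0 = contradiction pivot≡0 pivot≢0

linIndep-supported-≤ : ∀ {n m} (S : Fin n → Bool) (f : Fin m → Vecℤ n) →
  LinIndepℤ f → SupportedOn S f → m ≤ count S
linIndep-supported-≤ {zero}  {zero}  S f indep supp = z≤n
linIndep-supported-≤ {zero}  {suc m} S f indep supp with () ← indep (λ _ → 1ℤ) (λ ()) zero
linIndep-supported-≤ {suc n} {zero}  S f indep supp = z≤n
linIndep-supported-≤ {suc n} {suc m} S f indep supp with Finₚ.all? (λ k → f k zero ℤₚ.≟ 0ℤ)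
... | yes column₀≡0 = ℕₚ.≤-trans
  (linIndep-supported-≤ (tail S) (tail ∘ f) (linIndep-tail f indep column₀≡0) (λ k u → supp k (suc u)))
  (count-tail-≤ S)
... | no ¬column₀≡0 with Finₚ.¬∀⟶∃¬ _ _ (λ k → f k zero ℤₚ.≟ 0ℤ) ¬column₀≡0
...   | k₀ , pivot≢0 = ℕₚ.≤-trans
  (s≤s (linIndep-supported-≤ (tail S) (tail ∘ eliminate)
          (linIndep-tail eliminate (linIndep-eliminate indep pivot≢0) eliminate-pivot)
          (λ j u → supportedOn-eliminate S supp j (suc u))))
  (ℕₚ.≤-reflexive (sym (count-head S S₀)))
  where
  open Elimination f k₀ zero
  S₀ : T (S zero)
  S₀ = decidable-stable (T? (S zero)) (pivot≢0 ∘ supp k₀ zero)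

InEigenspaceℤ : ∀ {n} → Matℤ n → ℤ → Vecℤ n → Set
InEigenspaceℤ M η y = ∀ u → (M · y) u ≡ η ℤ.* y u

VanishesOn : ∀ {n} → (Fin n → Bool) → Vecℤ n → Set
VanishesOn S v = ∀ k → T (S k) → v k ≡ 0ℤ

InjectiveOnEigenspace : ∀ {n} → Matℤ n → ℤ → Matℤ n → (Fin n → Bool) → Set
InjectiveOnEigenspace M η β S = ∀ y → InEigenspaceℤ M η y → VanishesOn S (β · y) → ∀ u → y u ≡ 0ℤ

inEigenspace-lincomb : ∀ {n m} (M : Matℤ n) (η : ℤ) (c : Fin m → ℤ) (z : Fin m → Vecℤ n) →
  (∀ k → InEigenspaceℤ M η (z k)) → InEigenspaceℤ M η (λ u → sumℤ (λ k → c k ℤ.* z k u))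
inEigenspace-lincomb M η c z z-eigen u = begin
  (M · (λ u → sumℤ (λ k → c k ℤ.* z k u))) u  ≡⟨ ·-lincomb M c z u ⟩
  sumℤ (λ k → c k ℤ.* (M · z k) u)             ≡⟨ sumℤ-cong (λ k → cong (c k ℤ.*_) (z-eigen k u)) ⟩
  sumℤ (λ k → c k ℤ.* (η ℤ.* z k u))           ≡⟨ sumℤ-cong (λ k → ℤ*.x∙yz≈y∙xz (c k) η (z k u)) ⟩
  sumℤ (λ k → η ℤ.* (c k ℤ.* z k u))           ≡⟨ sumℤ-*ˡ η (λ k → c k ℤ.* z k u) ⟩
  η ℤ.* sumℤ (λ k → c k ℤ.* z k u)             ∎

linIndep-eigen-≤ : ∀ {n m} (M β : Matℤ n) (η : ℤ) (S : Fin n → Bool) → InjectiveOnEigenspace M η β S →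
  (z : Fin m → Vecℤ n) → LinIndepℤ z → (∀ k → InEigenspaceℤ M η (z k)) → m ≤ count S
linIndep-eigen-≤ M β η S injective z z-indep z-eigen = linIndep-supported-≤ S βz βz-indep βz-supp
  where
  βz : Fin _ → Vecℤ _
  βz k u = if S u then (β · z k) u else 0ℤ

  βz-supp : SupportedOn S βz
  βz-supp k u = if-¬T

  βz-indep : LinIndepℤ βz
  βz-indep c Σcβz≡0 = z-indep c (injective y (inEigenspace-lincomb M η c z z-eigen) βy-vanishes)
    where
    y : Vecℤ _
    y u = sumℤ (λ k → c k ℤ.* z k u)

    βy-vanishes : VanishesOn S (β · y)
    βy-vanishes u Su = begin
      (β · y) u                         ≡⟨ ·-lincomb β c z u ⟩
      sumℤ (λ k → c k ℤ.* (β · z k) u)  ≡⟨ sumℤ-cong (λ k → cong (c k ℤ.*_) (if-T Su)) ⟨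
      sumℤ (λ k → c k ℤ.* βz k u)       ≡⟨ Σcβz≡0 u ⟩
      0ℤ                                ∎

·-divide : ∀ {n} (N : Matℤ n) (c : ℤ) {y y′ : Vecℤ n} → (∀ u → y u ≡ y′ u ℤ.* c) →
  ∀ u → (N · y) u ≡ (N · y′) u ℤ.* c
·-divide N c {y′ = y′} y≡y′c u = trans (·-congʳ N y≡y′c u) (·-*ʳ N c y′ u)

inEigenspace-divide : ∀ {n} {M : Matℤ n} {η : ℤ} (c : ℤ) .{{_ : ℤ.NonZero c}} {y y′ : Vecℤ n} →
  (∀ u → y u ≡ y′ u ℤ.* c) → InEigenspaceℤ M η y → InEigenspaceℤ M η y′
inEigenspace-divide {M = M} {η} c {y} {y′} y≡y′c y-eigen u = ℤₚ.*-cancelʳ-≡ _ _ c (begin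
  (M · y′) u ℤ.* c    ≡⟨ ·-divide M c y≡y′c u ⟨
  (M · y) u           ≡⟨ y-eigen u ⟩
  η ℤ.* y u           ≡⟨ cong (η ℤ.*_) (y≡y′c u) ⟩
  η ℤ.* (y′ u ℤ.* c)  ≡⟨ ℤₚ.*-assoc η (y′ u) c ⟨
  η ℤ.* y′ u ℤ.* c    ∎)

vanishesOn-divide : ∀ {n} {β : Matℤ n} (S : Fin n → Bool) (c : ℤ) .{{_ : ℤ.NonZero c}} {y y′ : Vecℤ n} →
  (∀ u → y u ≡ y′ u ℤ.* c) → VanishesOn S (β · y) → VanishesOn S (β · y′)
vanishesOn-divide {β = β} S c y≡y′c βy-vanishes k Sk = ℤₚ.*-cancelʳ-≡ _ _ c
  (trans (sym (·-divide β c y≡y′c k)) (trans (βy-vanishes k Sk) (sym (ℤₚ.*-zeroˡ c))))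

first-drop : ∀ {P : ℕ → Set} → Decidable P → ∀ f → P 0 → ¬ P f → ∃ λ j → j < f × P j × ¬ P (suc j)
first-drop P? zero    P₀ ¬P₀ = contradiction P₀ ¬P₀
first-drop P? (suc f) P₀ ¬Pf with P? 1
... | no  ¬P₁ = 0 , s≤s z≤n , P₀ , ¬P₁
... | yes P₁ with first-drop (P? ∘ suc) f P₁ ¬Pf
...   | j , j<f , Pⱼ₊₁ , ¬Pⱼ₊₂ = suc j , s≤s j<f , Pⱼ₊₁ , ¬Pⱼ₊₂

module _ {p : ℕ} (p-prime : Prime p) where

  private instance
    p≢0 : ℕ.NonZero p
    p≢0 = prime⇒nonZero p-prime

  prime-power-∣-cancel : ∀ {a} → ¬ p ℕ∣.∣ a → ∀ j x → p ^ j ℕ∣.∣ x ℕ.* a → p ^ j ℕ∣.∣ x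
  prime-power-∣-cancel p∤a zero    x _ = ℕ∣.1∣ x
  prime-power-∣-cancel {a} p∤a (suc j) x pʲ⁺¹∣xa with euclidsLemma x a p-prime (ℕ∣.m*n∣⇒m∣ p (p ^ j) pʲ⁺¹∣xa)
  ... | inj₂ p∣a = contradiction p∣a p∤a
  ... | inj₁ (ℕ∣.divides q refl) = subst (p ^ suc j ℕ∣.∣_) (ℕₚ.*-comm p q) (ℕ∣.*-monoʳ-∣ p pʲ∣q)
    where
    qpa≡p[qa] : q ℕ.* p ℕ.* a ≡ p ℕ.* (q ℕ.* a)
    qpa≡p[qa] = trans (cong (ℕ._* a) (ℕₚ.*-comm q p)) (ℕₚ.*-assoc p q a)

    pʲ∣q : p ^ j ℕ∣.∣ q
    pʲ∣q = prime-power-∣-cancel p∤a j q (ℕ∣.*-cancelˡ-∣ p (subst (p ^ suc j ℕ∣.∣_) qpa≡p[qa] pʲ⁺¹∣xa))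

  prime-∣-of-balance : ∀ j (x a y b : ℤ) → x ℤ.* a ≡ y ℤ.* b →
    + (p ^ j) ∣ y → ¬ (+ (p ^ j) ∣ x) → + p ∣ₛ a
  prime-∣-of-balance j x a y b xa≡yb pʲ∣y pʲ∤x with p ℕ∣.∣? ℤ.∣ a ∣
  ... | yes p∣a = ℤ∣.∣ᵤ⇒∣ p∣a
  ... | no  p∤a = contradiction (prime-power-∣-cancel p∤a j ℤ.∣ x ∣ pʲ∣∣x∣∣a∣) pʲ∤x
    where
    ∣y∣∣b∣≡∣x∣∣a∣ : ℤ.∣ y ∣ ℕ.* ℤ.∣ b ∣ ≡ ℤ.∣ x ∣ ℕ.* ℤ.∣ a ∣
    ∣y∣∣b∣≡∣x∣∣a∣ = trans (sym (ℤₚ.abs-* y b)) (trans (cong ℤ.∣_∣ (sym xa≡yb)) (ℤₚ.abs-* x a))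
    pʲ∣∣x∣∣a∣ : p ^ j ℕ∣.∣ ℤ.∣ x ∣ ℕ.* ℤ.∣ a ∣
    pʲ∣∣x∣∣a∣ = subst (p ^ j ℕ∣.∣_) ∣y∣∣b∣≡∣x∣∣a∣ (ℕ∣.∣m⇒∣m*n ℤ.∣ b ∣ pʲ∣y)

  n<pⁿ : ∀ n → n < p ^ n
  n<pⁿ zero    = s≤s z≤n
  n<pⁿ (suc n) = ℕₚ.≤-trans (ℕₚ.+-mono-≤ (ℕₚ.m^n>0 p n) (n<pⁿ n)) pⁿ+pⁿ≤p·pⁿ
    where
    pⁿ+pⁿ≤p·pⁿ : p ^ n + p ^ n ≤ p ℕ.* p ^ n
    pⁿ+pⁿ≤p·pⁿ = subst (_≤ p ℕ.* p ^ n) (cong (_+_ (p ^ n)) (ℕₚ.+-identityʳ (p ^ n)))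
                   (ℕₚ.*-monoˡ-≤ (p ^ n) (ℕ.nonTrivial⇒n>1 p {{prime⇒nonTrivial p-prime}}))

  divisible-by-all-powers⇒0 : ∀ y → (∀ j → + (p ^ j) ∣ₛ y) → y ≡ 0ℤ
  divisible-by-all-powers⇒0 y pʲ∣y with ℤ.∣ y ∣ in ∣y∣≡
  ... | zero  = ℤₚ.∣i∣≡0⇒i≡0 ∣y∣≡
  ... | suc k = contradiction (ℕ∣.∣⇒≤ (subst (p ^ suc k ℕ∣.∣_) ∣y∣≡ (ℤ∣.∣⇒∣ᵤ (pʲ∣y (suc k))))) (ℕₚ.<⇒≱ (n<pⁿ (suc k)))

  p-descent : ∀ {n} (H : Vecℤ n → Set) →
    (∀ {y y′} → (∀ u → y u ≡ y′ u ℤ.* + p) → H y → H y′) →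
    (∀ {y} → H y → ∀ u → + p ∣ₛ y u) →
    ∀ {y} → H y → ∀ u → y u ≡ 0ℤ
  p-descent H divide divisible {y} Hy u = divisible-by-all-powers⇒0 (y u) (λ j → pʲ∣ j Hy u)
    where
    pʲ∣ : ∀ j {y} → H y → ∀ u → + (p ^ j) ∣ₛ y u
    pʲ∣ zero    {y} Hy u = divides (y u) (sym (ℤₚ.*-identityʳ (y u)))
    pʲ∣ (suc j) {y} Hy u = subst₂ _∣ₛ_ pʲp≡pʲ⁺¹ (sym (y≡y′p u)) (ℤ∣.*-monoˡ-∣ (+ p) (pʲ∣ j (divide {y} {y′} y≡y′p Hy) u))
      where
      y′ : Vecℤ _
      y′ u = ℤ∣.quotient (divisible Hy u)
      y≡y′p : ∀ u → y u ≡ y′ u ℤ.* + p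
      y≡y′p u = ℤ∣._∣_.equality (divisible Hy u)
      pʲp≡pʲ⁺¹ : + (p ^ j) ℤ.* + p ≡ + (p ^ suc j)
      pʲp≡pʲ⁺¹ = trans (sym (ℤₚ.pos-* (p ^ j) p)) (cong +_ (ℕₚ.*-comm (p ^ j) p))

  injective-by-descent : ∀ {n} {M : Matℤ n} {η : ℤ} {S : Fin n → Bool} (β β⁻¹ : Matℤ n) →
    (∀ i j → (β⁻¹ ⊗ β) i j ≡ idMat i j) →
    (∀ {y} → InEigenspaceℤ M η y → VanishesOn S (β · y) → ∀ k → + p ∣ₛ (β · y) k) →
    InjectiveOnEigenspace M η β S
  injective-by-descent {n} {M} {η} {S} β β⁻¹ β⁻¹β≡I p∣βy y y-eigen βy-vanishes =
    p-descent H divide divisible (y-eigen , βy-vanishes)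
    where
    H : Vecℤ n → Set
    H y = InEigenspaceℤ M η y × VanishesOn S (β · y)

    divide : ∀ {y y′} → (∀ u → y u ≡ y′ u ℤ.* + p) → H y → H y′
    divide {y} {y′} y≡y′p (y-eigen , βy-vanishes) =
      inEigenspace-divide {M = M} {η} (+ p) {y} {y′} y≡y′p y-eigen , vanishesOn-divide {β = β} S (+ p) {y} {y′} y≡y′p βy-vanishes

    divisible : ∀ {y} → H y → ∀ u → + p ∣ₛ y u
    divisible {y} (y-eigen , βy-vanishes) u =
      subst (+ p ∣ₛ_) (·-inverse β⁻¹ β β⁻¹β≡I y u) (∣ₛ-· (+ p) β⁻¹ (β · y) (p∣βy y-eigen βy-vanishes) u)

  exactPowerᵇ : ℕ → ℕ → Bool
  exactPowerᵇ j a = not (isZeroᵇ a) ∧ divisibleᵇ (p ^ j) a ∧ not (divisibleᵇ (p ^ suc j) a)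

  T-exactPower : ∀ j {a} → a ≢ 0 → p ^ j ℕ∣.∣ a → ¬ p ^ suc j ℕ∣.∣ a → T (exactPowerᵇ j a)
  T-exactPower j a≢0 pʲ∣a pʲ⁺¹∤a =
    Equivalence.from T-∧ (≢0⇒not-isZeroᵇ a≢0 , Equivalence.from T-∧ (∣⇒divisibleᵇ pʲ∣a , ∤⇒not-divisibleᵇ pʲ⁺¹∤a))

  count-not-divisible-≤ : ∀ {n} (s : Fin n → ℕ) i →
    count (λ k → not (divisibleᵇ (p ^ suc i) (s k))) ≤ eSumUpTo p s i
  count-not-divisible-≤ s i = count-≤-cover _ (λ j k → exactPowerᵇ (Fin.toℕ j) (s k)) cover
    where
    cover : ∀ k → T (not (divisibleᵇ (p ^ suc i) (s k))) → ∃ λ (j : Fin (suc i)) → T (exactPowerᵇ (Fin.toℕ j) (s k))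
    cover k pⁱ⁺¹∤sₖ = to-index (first-drop (λ j → p ^ j ℕ∣.∣? s k) (suc i) (ℕ∣.1∣ s k) (not-divisibleᵇ⇒∤ pⁱ⁺¹∤sₖ))
      where
      sₖ≢0 : s k ≢ 0
      sₖ≢0 sₖ≡0 = not-divisibleᵇ⇒∤ pⁱ⁺¹∤sₖ (subst (p ^ suc i ℕ∣.∣_) (sym sₖ≡0) (ℕ∣._∣0 (p ^ suc i)))

      to-index : (∃ λ j → j < suc i × p ^ j ℕ∣.∣ s k × ¬ p ^ suc j ℕ∣.∣ s k) →
                 ∃ λ (j : Fin (suc i)) → T (exactPowerᵇ (Fin.toℕ j) (s k))
      to-index (j , j<i+1 , pʲ∣sₖ , pʲ⁺¹∤sₖ) =
        Fin.fromℕ< j<i+1 , subst (λ t → T (exactPowerᵇ t (s k))) (sym (Finₚ.toℕ-fromℕ< j<i+1)) (T-exactPower j sₖ≢0 pʲ∣sₖ pʲ⁺¹∤sₖ)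

  count-divisible-≤ : ∀ {n} (s : Fin n → ℕ) i →
    count (λ k → divisibleᵇ (p ^ i) (s k)) ≤ count (λ k → isZeroᵇ (s k)) + eSumFrom p s i
  count-divisible-≤ s i = ℕₚ.≤-trans (count-≤-union _ _ N zero-or-N)
    (ℕₚ.+-monoʳ-≤ (count (λ k → isZeroᵇ (s k))) (count-≤-cover N (λ j k → exactPowerᵇ (i + Fin.toℕ j) (s k)) cover))
    where
    N : Fin _ → Bool
    N k = not (isZeroᵇ (s k)) ∧ divisibleᵇ (p ^ i) (s k)

    zero-or-N : ∀ k → T (divisibleᵇ (p ^ i) (s k)) → T (isZeroᵇ (s k)) ⊎ T (N k)
    zero-or-N k pⁱ∣sₖ with s k ℕ.≟ 0
    ... | yes _ = inj₁ _
    ... | no  _ = inj₂ pⁱ∣sₖ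

    B : ℕ
    B = sumℕ s

    cover : ∀ k → T (N k) → ∃ λ (j : Fin (suc B)) → T (exactPowerᵇ (i + Fin.toℕ j) (s k))
    cover k Nₖ = to-index (first-drop (λ j → p ^ (i + j) ℕ∣.∣? s k) (suc B) pⁱ⁺⁰∣sₖ pⁱ⁺ᴮ⁺¹∤sₖ)
      where
      sₖ≢0 : s k ≢ 0
      sₖ≢0 = not-isZeroᵇ⇒≢0 (proj₁ (Equivalence.to T-∧ Nₖ))

      pⁱ⁺⁰∣sₖ : p ^ (i + 0) ℕ∣.∣ s k
      pⁱ⁺⁰∣sₖ = subst (λ t → p ^ t ℕ∣.∣ s k) (sym (ℕₚ.+-identityʳ i)) (divisibleᵇ⇒∣ (proj₂ (Equivalence.to T-∧ Nₖ)))

      sₖ<pⁱ⁺ᴮ⁺¹ : s k < p ^ (i + suc B)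
      sₖ<pⁱ⁺ᴮ⁺¹ = ℕₚ.≤-trans (s≤s (term≤sumℕ s k))
                    (ℕₚ.≤-trans (ℕₚ.<⇒≤ (n<pⁿ (suc B))) (ℕₚ.^-monoʳ-≤ p (ℕₚ.m≤n+m (suc B) i)))

      pⁱ⁺ᴮ⁺¹∤sₖ : ¬ p ^ (i + suc B) ℕ∣.∣ s k
      pⁱ⁺ᴮ⁺¹∤sₖ pⁱ⁺ᴮ⁺¹∣sₖ = ℕₚ.<⇒≱ sₖ<pⁱ⁺ᴮ⁺¹ (ℕ∣.∣⇒≤ {{ℕ.≢-nonZero sₖ≢0}} pⁱ⁺ᴮ⁺¹∣sₖ)

      to-index : (∃ λ j → j < suc B × p ^ (i + j) ℕ∣.∣ s k × ¬ p ^ (i + suc j) ℕ∣.∣ s k) →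
                 ∃ λ (j : Fin (suc B)) → T (exactPowerᵇ (i + Fin.toℕ j) (s k))
      to-index (j , j<B+1 , pⁱ⁺ʲ∣sₖ , pⁱ⁺ʲ⁺¹∤sₖ) =
        Fin.fromℕ< j<B+1 , subst (λ t → T (exactPowerᵇ (i + t) (s k))) (sym (Finₚ.toℕ-fromℕ< j<B+1))
          (T-exactPower (i + j) sₖ≢0 pⁱ⁺ʲ∣sₖ (pⁱ⁺ʲ⁺¹∤sₖ ∘ subst (λ t → p ^ t ℕ∣.∣ s k) (sym (ℕₚ.+-suc i j))))

module SmithForm {n} (L : Matℤ n) (s : Fin n → ℕ) (U V U⁻¹ V⁻¹ : Matℤ n)
  (ULV≡diag : ∀ i j → ((U ⊗ L) ⊗ V) i j ≡ diagMat s i j)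
  (VV⁻¹≡I : ∀ i j → (V ⊗ V⁻¹) i j ≡ idMat i j)
  (V⁻¹V≡I : ∀ i j → (V⁻¹ ⊗ V) i j ≡ idMat i j)
  (U⁻¹U≡I : ∀ i j → (U⁻¹ ⊗ U) i j ≡ idMat i j) where

  sV⁻¹y≡ULy : ∀ y k → + s k ℤ.* (V⁻¹ · y) k ≡ (U · L · y) k
  sV⁻¹y≡ULy y k = begin
    + s k ℤ.* (V⁻¹ · y) k     ≡⟨ diagMat-· s (V⁻¹ · y) k ⟨
    (diagMat s · V⁻¹ · y) k    ≡⟨ ·-congˡ (V⁻¹ · y) ULV≡diag k ⟨
    (((U ⊗ L) ⊗ V) · V⁻¹ · y) k ≡⟨ ⊗-· (U ⊗ L) V (V⁻¹ · y) k ⟩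
    ((U ⊗ L) · V · V⁻¹ · y) k  ≡⟨ ·-congʳ (U ⊗ L) (·-inverse V V⁻¹ VV⁻¹≡I y) k ⟩
    ((U ⊗ L) · y) k            ≡⟨ ⊗-· U L y k ⟩
    (U · L · y) k              ∎

  sV⁻¹y≡ηUy : ∀ {η y} → InEigenspaceℤ L η y → ∀ k → + s k ℤ.* (V⁻¹ · y) k ≡ η ℤ.* (U · y) k
  sV⁻¹y≡ηUy {η} {y} y-eigen k = trans (sV⁻¹y≡ULy y k) (trans (·-congʳ U y-eigen k) (·-*ˡ U η y k))

  module _ {p : ℕ} (p-prime : Prime p) where

    injective-V⁻¹ : ∀ i η → + (p ^ i) ∣ η → InjectiveOnEigenspace L η V⁻¹ (λ k → divisibleᵇ (p ^ i) (s k))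
    injective-V⁻¹ i η pⁱ∣η =
      injective-by-descent p-prime {M = L} {η} {λ k → divisibleᵇ (p ^ i) (s k)} V⁻¹ V VV⁻¹≡I p∣V⁻¹y
      where
      p∣V⁻¹y : ∀ {y} → InEigenspaceℤ L η y → VanishesOn (λ k → divisibleᵇ (p ^ i) (s k)) (V⁻¹ · y) →
        ∀ k → + p ∣ₛ (V⁻¹ · y) k
      p∣V⁻¹y {y} y-eigen vanishes k with p ^ i ℕ∣.∣? s k
      ... | yes pⁱ∣sₖ = subst (+ p ∣ₛ_) (sym (vanishes k (∣⇒divisibleᵇ pⁱ∣sₖ))) (divides 0ℤ refl)
      ... | no  pⁱ∤sₖ = prime-∣-of-balance p-prime i (+ s k) ((V⁻¹ · y) k) η ((U · y) k)
                          (sV⁻¹y≡ηUy {η} {y} y-eigen k) pⁱ∣η pⁱ∤sₖ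

    injective-U : ∀ i η → ¬ (+ (p ^ suc i) ∣ η) →
      InjectiveOnEigenspace L η U (λ k → not (divisibleᵇ (p ^ suc i) (s k)))
    injective-U i η pⁱ⁺¹∤η =
      injective-by-descent p-prime {M = L} {η} {λ k → not (divisibleᵇ (p ^ suc i) (s k))} U U⁻¹ U⁻¹U≡I p∣Uy
      where
      p∣Uy : ∀ {y} → InEigenspaceℤ L η y → VanishesOn (λ k → not (divisibleᵇ (p ^ suc i) (s k))) (U · y) →
        ∀ k → + p ∣ₛ (U · y) k
      p∣Uy {y} y-eigen vanishes k with p ^ suc i ℕ∣.∣? s k
      ... | yes pⁱ⁺¹∣sₖ = prime-∣-of-balance p-prime (suc i) η ((U · y) k) (+ s k) ((V⁻¹ · y) k)
                            (sym (sV⁻¹y≡ηUy {η} {y} y-eigen k)) pⁱ⁺¹∣sₖ pⁱ⁺¹∤η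
      ... | no  pⁱ⁺¹∤sₖ = subst (+ p ∣ₛ_) (sym (vanishes k (∤⇒not-divisibleᵇ pⁱ⁺¹∤sₖ))) (divides 0ℤ refl)

  column : Fin n → Vecℤ n
  column k u = V u k

  V⁻¹-column : ∀ k j → (V⁻¹ · column k) j ≡ idMat j k
  V⁻¹-column k j = V⁻¹V≡I j k

  column-in-kernel : ∀ k → s k ≡ 0 → ∀ u → (L · column k) u ≡ 0ℤ
  column-in-kernel k sₖ≡0 u = trans (sym (·-inverse U⁻¹ U U⁻¹U≡I (L · column k) u)) (·-zero U⁻¹ ULv≡0 u)
    where
    sⱼδⱼₖ≡0 : ∀ j → + s j ℤ.* idMat j k ≡ 0ℤ
    sⱼδⱼₖ≡0 j with j Fin.≟ k
    ... | yes refl rewrite sₖ≡0 = refl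
    ... | no  _    = ℤₚ.*-zeroʳ (+ s j)

    ULv≡0 : ∀ j → (U · L · column k) j ≡ 0ℤ
    ULv≡0 j = trans (sym (sV⁻¹y≡ULy (column k) j)) (trans (cong (+ s j ℤ.*_) (V⁻¹-column k j)) (sⱼδⱼₖ≡0 j))

  at-most-one-zero-factor : (∀ y → (∀ u → (L · y) u ≡ 0ℤ) → ∀ u w → y u ≡ y w) →
    count (λ k → isZeroᵇ (s k)) ≤ 1
  at-most-one-zero-factor kernel-constant = count-≤-1 _ unique
    where
    unique : ∀ k k′ → T (isZeroᵇ (s k)) → T (isZeroᵇ (s k′)) → k ≡ k′
    unique k k′ zₖ zₖ′ with k Fin.≟ k′
    ... | yes k≡k′ = k≡k′
    ... | no  k≢k′ = contradiction (trans (sym (idMat-diag k′)) (trans (sym (V⁻¹-column k′ k′)) (·-zero V⁻¹ v′≡0 k′))) λ ()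
      where
      v v′ : Vecℤ n
      v  = column k
      v′ = column k′

      v≡vₖ : ∀ u → v u ≡ v k
      v≡vₖ u = kernel-constant v (column-in-kernel k (isZeroᵇ⇒≡0 zₖ)) u k

      v′≡v′ₖ : ∀ u → v′ u ≡ v′ k
      v′≡v′ₖ u = kernel-constant v′ (column-in-kernel k′ (isZeroᵇ⇒≡0 zₖ′)) u k

      proportional : ∀ u → v u ℤ.* v′ k ≡ v′ u ℤ.* v k
      proportional u = begin
        v u ℤ.* v′ k   ≡⟨ cong (ℤ._* v′ k) (v≡vₖ u) ⟩
        v k ℤ.* v′ k   ≡⟨ ℤₚ.*-comm (v k) (v′ k) ⟩
        v′ k ℤ.* v k   ≡⟨ cong (ℤ._* v k) (v′≡v′ₖ u) ⟨
        v′ u ℤ.* v k   ∎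

      v′ₖ≡0 : v′ k ≡ 0ℤ
      v′ₖ≡0 = begin
        v′ k                             ≡⟨ ℤₚ.*-identityˡ (v′ k) ⟨
        1ℤ ℤ.* v′ k                      ≡⟨ cong (ℤ._* v′ k) (trans (sym (idMat-diag k)) (sym (V⁻¹-column k k))) ⟩
        (V⁻¹ · v) k ℤ.* v′ k             ≡⟨ ·-*ʳ V⁻¹ (v′ k) v k ⟨
        (V⁻¹ · (λ u → v u ℤ.* v′ k)) k   ≡⟨ ·-congʳ V⁻¹ proportional k ⟩
        (V⁻¹ · (λ u → v′ u ℤ.* v k)) k   ≡⟨ ·-*ʳ V⁻¹ (v k) v′ k ⟩
        (V⁻¹ · v′) k ℤ.* v k             ≡⟨ cong (ℤ._* v k) (trans (V⁻¹-column k′ k) (idMat-off-diag k≢k′)) ⟩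
        0ℤ ℤ.* v k                       ≡⟨ ℤₚ.*-zeroˡ (v k) ⟩
        0ℤ                               ∎

      v′≡0 : ∀ u → v′ u ≡ 0ℤ
      v′≡0 u = trans (v′≡v′ₖ u) v′ₖ≡0

degree-as-sum : ∀ {n} (G : Graph n) w → + degree G w ≡ sumℤ (adjMat G w)
degree-as-sum G w = trans (+sumℕ (𝟙 ∘ adj G w)) (sumℤ-cong (λ x → +𝟙 (adj G w x)))
  where
  +𝟙 : ∀ b → + 𝟙 b ≡ (if b then 1ℤ else 0ℤ)
  +𝟙 true  = refl
  +𝟙 false = refl

laplacian-· : ∀ {n} (G : Graph n) (y : Vecℤ n) w →
  (laplacian G · y) w ≡ sumℤ (λ x → adjMat G w x ℤ.* (y w ℤ.- y x))
laplacian-· G y w = begin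
  sumℤ (λ x → (degMat G w x ℤ.- adjMat G w x) ℤ.* y x)
    ≡⟨ sumℤ-cong (λ x → distribʳ (degMat G w x) (adjMat G w x) (y x)) ⟩
  sumℤ (λ x → degMat G w x ℤ.* y x ℤ.- adjMat G w x ℤ.* y x)
    ≡⟨ sumℤ-- (λ x → degMat G w x ℤ.* y x) (λ x → adjMat G w x ℤ.* y x) ⟩
  (degMat G · y) w ℤ.- Σay
    ≡⟨ cong (λ t → t ℤ.- Σay) (diagMat-· (degree G) y w) ⟩
  + degree G w ℤ.* y w ℤ.- Σay
    ≡⟨ cong (λ t → t ℤ.* y w ℤ.- Σay) (degree-as-sum G w) ⟩
  sumℤ (adjMat G w) ℤ.* y w ℤ.- Σay
    ≡⟨ cong (λ t → t ℤ.- Σay) (sumℤ-*ʳ (y w) (adjMat G w)) ⟨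
  sumℤ (λ x → adjMat G w x ℤ.* y w) ℤ.- Σay
    ≡⟨ sumℤ-- (λ x → adjMat G w x ℤ.* y w) (λ x → adjMat G w x ℤ.* y x) ⟨
  sumℤ (λ x → adjMat G w x ℤ.* y w ℤ.- adjMat G w x ℤ.* y x)
    ≡⟨ sumℤ-cong (λ x → distribˡ (adjMat G w x) (y w) (y x)) ⟩
  sumℤ (λ x → adjMat G w x ℤ.* (y w ℤ.- y x)) ∎
  where
  Σay : ℤ
  Σay = sumℤ (λ x → adjMat G w x ℤ.* y x)
  distribʳ : ∀ a b c → (a ℤ.- b) ℤ.* c ≡ a ℤ.* c ℤ.- b ℤ.* c
  distribʳ = solve-∀
  distribˡ : ∀ a b c → a ℤ.* b ℤ.- a ℤ.* c ≡ a ℤ.* (b ℤ.- c)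
  distribˡ = solve-∀

module _ {n} (G : Graph n) (y : Vecℤ n) (harmonic : ∀ u → (laplacian G · y) u ≡ 0ℤ)
         {M : ℤ} (y≤M : ∀ x → y x ℤ.≤ M) where

  maximum-spreads : ∀ {w x} → adj G w x ≡ true → y w ≡ M → y x ≡ M
  maximum-spreads {w} {x} wx yw≡M = trans (sym (ℤₚ.i-j≡0⇒i≡j (y w) (y x) yw-yx≡0)) yw≡M
    where
    t : Vecℤ n
    t z = adjMat G w z ℤ.* (y w ℤ.- y z)

    t≥0 : ∀ z → 0ℤ ℤ.≤ t z
    t≥0 z with adj G w z
    ... | true  = subst (0ℤ ℤ.≤_) (sym (ℤₚ.*-identityˡ _)) (ℤₚ.i≤j⇒0≤j-i (subst (y z ℤ.≤_) (sym yw≡M) (y≤M z)))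
    ... | false = subst (0ℤ ℤ.≤_) (sym (ℤₚ.*-zeroˡ (y w ℤ.- y z))) ℤₚ.≤-refl

    yw-yx≡0 : y w ℤ.- y x ≡ 0ℤ
    yw-yx≡0 = begin
      y w ℤ.- y x          ≡⟨ ℤₚ.*-identityˡ _ ⟨
      1ℤ ℤ.* (y w ℤ.- y x) ≡⟨ cong (λ b → (if b then 1ℤ else 0ℤ) ℤ.* (y w ℤ.- y x)) wx ⟨
      t x                  ≡⟨ sumℤ-nonneg-zero t t≥0 (trans (sym (laplacian-· G y w)) (harmonic w)) x ⟩
      0ℤ                   ∎

  walk-preserves-maximum : ∀ {u v} → Walk G u v → y u ≡ M → y v ≡ M
  walk-preserves-maximum here           yu≡M = yu≡M
  walk-preserves-maximum (step uw walk) yu≡M = walk-preserves-maximum walk (maximum-spreads uw yu≡M)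

maximum-exists : ∀ {n} (y : Vecℤ (suc n)) → ∃ λ m → ∀ u → y u ℤ.≤ y m
maximum-exists {zero}  y = zero , λ where zero → ℤₚ.≤-refl
maximum-exists {suc n} y with maximum-exists (tail y)
... | m , y≤yₘ with y zero ℤₚ.≤? y (suc m)
...   | yes y₀≤yₘ = suc m , λ where
  zero    → y₀≤yₘ
  (suc u) → y≤yₘ u
...   | no  y₀≰yₘ = zero , λ where
  zero    → ℤₚ.≤-refl
  (suc u) → ℤₚ.≤-trans (y≤yₘ u) (ℤₚ.<⇒≤ (ℤₚ.≰⇒> y₀≰yₘ))

laplacian-kernel-constant : ∀ {n} (G : Graph n) → Connected G →
  ∀ y → (∀ u → (laplacian G · y) u ≡ 0ℤ) → ∀ u w → y u ≡ y w
laplacian-kernel-constant {suc n} G connected y harmonic u w =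
  trans (from-maximum u) (sym (from-maximum w))
  where
  m : Fin (suc n)
  m = proj₁ (maximum-exists y)
  from-maximum : ∀ v → y v ≡ y m
  from-maximum v = walk-preserves-maximum G y harmonic (proj₂ (maximum-exists y)) (connected m v) refl

toℚᵘ-toℚ : ∀ z → ℚ.toℚᵘ (toℚ z) ℚᵘ.≃ (z ℚᵘ./ 1)
toℚᵘ-toℚ z = ℚₚ.toℚᵘ-fromℚᵘ (z ℚᵘ./ 1)

toℚ-+ : ∀ a b → toℚ (a ℤ.+ b) ≡ toℚ a ℚ.+ toℚ b
toℚ-+ a b = ℚₚ.toℚᵘ-injective (ℚᵘₚ.≃-trans (toℚᵘ-toℚ (a ℤ.+ b)) (ℚᵘₚ.≃-trans (ℚᵘ.*≡* (over-one a b))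
  (ℚᵘₚ.≃-trans (ℚᵘₚ.+-cong (ℚᵘₚ.≃-sym (toℚᵘ-toℚ a)) (ℚᵘₚ.≃-sym (toℚᵘ-toℚ b))) (ℚᵘₚ.≃-sym (ℚₚ.toℚᵘ-homo-+ (toℚ a) (toℚ b))))))
  where
  over-one : ∀ a b → (a ℤ.+ b) ℤ.* 1ℤ ≡ (a ℤ.* 1ℤ ℤ.+ b ℤ.* 1ℤ) ℤ.* 1ℤ
  over-one = solve-∀

toℚ-* : ∀ a b → toℚ (a ℤ.* b) ≡ toℚ a ℚ.* toℚ b
toℚ-* a b = ℚₚ.toℚᵘ-injective (ℚᵘₚ.≃-trans (toℚᵘ-toℚ (a ℤ.* b))
  (ℚᵘₚ.≃-trans (ℚᵘₚ.*-cong (ℚᵘₚ.≃-sym (toℚᵘ-toℚ a)) (ℚᵘₚ.≃-sym (toℚᵘ-toℚ b))) (ℚᵘₚ.≃-sym (ℚₚ.toℚᵘ-homo-* (toℚ a) (toℚ b)))))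

toℚ-injective : ∀ {a b} → toℚ a ≡ toℚ b → a ≡ b
toℚ-injective {a} {b} eq with ℚᵘₚ.≃-trans (ℚᵘₚ.≃-sym (toℚᵘ-toℚ a)) (ℚᵘₚ.≃-trans (ℚₚ.toℚᵘ-cong eq) (toℚᵘ-toℚ b))
... | ℚᵘ.*≡* a1≡b1 = trans (sym (ℤₚ.*-identityʳ a)) (trans a1≡b1 (ℤₚ.*-identityʳ b))

toℚ-sumℤ : ∀ {n} (f : Vecℤ n) → sumℚ (toℚ ∘ f) ≡ toℚ (sumℤ f)
toℚ-sumℤ {zero}  f = refl
toℚ-sumℤ {suc n} f = trans (cong (ℚ._+_ (toℚ (f zero))) (toℚ-sumℤ (tail f))) (sym (toℚ-+ (f zero) _))

sumℚ-cong : ∀ {n} {f g : Fin n → ℚ} → (∀ i → f i ≡ g i) → sumℚ f ≡ sumℚ g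
sumℚ-cong {zero}  f≗g = refl
sumℚ-cong {suc n} f≗g = cong₂ ℚ._+_ (f≗g zero) (sumℚ-cong (f≗g ∘ suc))

sumℚ-*ˡ : ∀ {n} (c : ℚ) (f : Fin n → ℚ) → sumℚ (λ i → c ℚ.* f i) ≡ c ℚ.* sumℚ f
sumℚ-*ˡ {zero}  c f = sym (ℚₚ.*-zeroʳ c)
sumℚ-*ˡ {suc n} c f = trans (cong (ℚ._+_ (c ℚ.* f zero)) (sumℚ-*ˡ c (tail f))) (sym (ℚₚ.*-distribˡ-+ c (f zero) _))

productℕ : ∀ {n} → (Fin n → ℕ) → ℕ
productℕ {zero}  f = 1
productℕ {suc n} f = f zero ℕ.* productℕ (tail f)

factor∣productℕ : ∀ {n} (f : Fin n → ℕ) k → f k ℕ∣.∣ productℕ f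
factor∣productℕ f zero    = ℕ∣.m∣m*n _
factor∣productℕ f (suc k) = ℕ∣.∣n⇒∣m*n (f zero) (factor∣productℕ (tail f) k)

productℕ≢0 : ∀ {n} (f : Fin n → ℕ) → (∀ k → f k ≢ 0) → productℕ f ≢ 0
productℕ≢0 {zero}  f f≢0 ()
productℕ≢0 {suc n} f f≢0 ∏≡0 with ℕₚ.m*n≡0⇒m≡0∨n≡0 (f zero) ∏≡0
... | inj₁ f₀≡0 = f≢0 zero f₀≡0
... | inj₂ ∏≡0′ = productℕ≢0 (tail f) (f≢0 ∘ suc) ∏≡0′

numerator-scaled : ∀ (q : ℚ) (t D : ℕ) → D ≡ t ℕ.* ℚ.↧ₙ q → toℚ (ℚ.↥ q ℤ.* + t) ≡ toℚ (+ D) ℚ.* q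
numerator-scaled q@(mkℚ a d _) t D D≡t↧q = ℚₚ.toℚᵘ-injective (ℚᵘₚ.≃-trans (toℚᵘ-toℚ (a ℤ.* + t))
  (ℚᵘₚ.≃-trans (ℚᵘ.*≡* cross-multiplied)
    (ℚᵘₚ.≃-trans (ℚᵘₚ.*-cong (ℚᵘₚ.≃-sym (toℚᵘ-toℚ (+ D))) ℚᵘₚ.≃-refl) (ℚᵘₚ.≃-sym (ℚₚ.toℚᵘ-homo-* (toℚ (+ D)) q)))))
  where
  cross-multiplied : a ℤ.* + t ℤ.* + suc (d ℕ.+ 0) ≡ + D ℤ.* a ℤ.* 1ℤ
  cross-multiplied = begin
    a ℤ.* + t ℤ.* + suc (d ℕ.+ 0)  ≡⟨ cong (λ e → a ℤ.* + t ℤ.* + suc e) (ℕₚ.+-identityʳ d) ⟩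
    a ℤ.* + t ℤ.* + suc d          ≡⟨ reorder a (+ t) (+ suc d) ⟩
    + t ℤ.* + suc d ℤ.* a ℤ.* 1ℤ   ≡⟨ cong (λ e → e ℤ.* a ℤ.* 1ℤ) (trans (sym (ℤₚ.pos-* t (suc d))) (cong +_ (sym D≡t↧q))) ⟩
    + D ℤ.* a ℤ.* 1ℤ               ∎
    where
    reorder : ∀ a t d → a ℤ.* t ℤ.* d ≡ t ℤ.* d ℤ.* a ℤ.* 1ℤ
    reorder = solve-∀

clear-denominators : ∀ {n} (x : Fin n → ℚ) → ∃ λ D → D ≢ 0 × ∃ λ (z : Vecℤ n) → ∀ u → toℚ (z u) ≡ toℚ (+ D) ℚ.* x u
clear-denominators x = D , productℕ≢0 (ℚ.ℚ.denominatorℕ ∘ x) (λ u ()) , z , z≡Dx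
  where
  D = productℕ (ℚ.ℚ.denominatorℕ ∘ x)
  z : Vecℤ _
  z u = ℚ.↥ (x u) ℤ.* + ℕ∣.quotient (factor∣productℕ (ℚ.ℚ.denominatorℕ ∘ x) u)
  z≡Dx : ∀ u → toℚ (z u) ≡ toℚ (+ D) ℚ.* x u
  z≡Dx u = numerator-scaled (x u) _ D (ℕ∣.m∣n⇒n≡quotient*m (factor∣productℕ (ℚ.ℚ.denominatorℕ ∘ x) u))

inEigenspace-scaled : ∀ {n} (M : Matℤ n) (η : ℤ) {x : Fin n → ℚ} {z : Vecℤ n} (d : ℚ) →
  (∀ u → toℚ (z u) ≡ d ℚ.* x u) → InEigenspace M η x → InEigenspaceℤ M η z
inEigenspace-scaled M η {x} {z} d z≡dx x-eigen u = toℚ-injective (begin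
  toℚ ((M · z) u)                           ≡⟨ toℚ-sumℤ (λ v → M u v ℤ.* z v) ⟨
  sumℚ (λ v → toℚ (M u v ℤ.* z v))          ≡⟨ sumℚ-cong (λ v → toℚ-* (M u v) (z v)) ⟩
  sumℚ (λ v → toℚ (M u v) ℚ.* toℚ (z v))    ≡⟨ sumℚ-cong (λ v → cong (toℚ (M u v) ℚ.*_) (z≡dx v)) ⟩
  sumℚ (λ v → toℚ (M u v) ℚ.* (d ℚ.* x v))  ≡⟨ sumℚ-cong (λ v → ℚ*.x∙yz≈y∙xz (toℚ (M u v)) d (x v)) ⟩
  sumℚ (λ v → d ℚ.* (toℚ (M u v) ℚ.* x v))  ≡⟨ sumℚ-*ˡ d (λ v → toℚ (M u v) ℚ.* x v) ⟩
  d ℚ.* sumℚ (λ v → toℚ (M u v) ℚ.* x v)    ≡⟨ cong (d ℚ.*_) (x-eigen u) ⟩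
  d ℚ.* (toℚ η ℚ.* x u)                     ≡⟨ ℚ*.x∙yz≈y∙xz d (toℚ η) (x u) ⟩
  toℚ η ℚ.* (d ℚ.* x u)                     ≡⟨ cong (toℚ η ℚ.*_) (z≡dx u) ⟨
  toℚ η ℚ.* toℚ (z u)                       ≡⟨ toℚ-* η (z u) ⟨
  toℚ (η ℤ.* z u)                           ∎)

linIndep-scaled : ∀ {n m} {x : Fin m → Fin n → ℚ} {z : Fin m → Vecℤ n} (D : Fin m → ℕ) → (∀ k → D k ≢ 0) →
  (∀ k u → toℚ (z k u) ≡ toℚ (+ D k) ℚ.* x k u) → LinIndep x → LinIndepℤ z
linIndep-scaled {x = x} {z} D D≢0 z≡Dx x-indep c Σcz≡0 k
  with ℤₚ.i*j≡0⇒i≡0∨j≡0 (c k) (toℚ-injective (trans (toℚ-* (c k) (+ D k)) (x-indep c′ Σc′x≡0 k)))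
  where
  c′ : Fin _ → ℚ
  c′ k = toℚ (c k) ℚ.* toℚ (+ D k)

  Σc′x≡0 : ∀ u → sumℚ (λ k → c′ k ℚ.* x k u) ≡ ℚ.0ℚ
  Σc′x≡0 u = begin
    sumℚ (λ k → c′ k ℚ.* x k u)                     ≡⟨ sumℚ-cong (λ k → ℚₚ.*-assoc (toℚ (c k)) _ (x k u)) ⟩
    sumℚ (λ k → toℚ (c k) ℚ.* (toℚ (+ D k) ℚ.* x k u)) ≡⟨ sumℚ-cong (λ k → cong (toℚ (c k) ℚ.*_) (z≡Dx k u)) ⟨
    sumℚ (λ k → toℚ (c k) ℚ.* toℚ (z k u))          ≡⟨ sumℚ-cong (λ k → toℚ-* (c k) (z k u)) ⟨
    sumℚ (λ k → toℚ (c k ℤ.* z k u))   ≡⟨ toℚ-sumℤ (λ k → c k ℤ.* z k u) ⟩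
    toℚ (sumℤ (λ k → c k ℤ.* z k u))   ≡⟨ cong toℚ (Σcz≡0 u) ⟩
    ℚ.0ℚ                               ∎
... | inj₁ cₖ≡0 = cₖ≡0
... | inj₂ Dₖ≡0 = contradiction (cong ℤ.∣_∣ Dₖ≡0) (D≢0 k)

integral-eigenbasis : ∀ {n m} (M : Matℤ n) (η : ℤ) (x : Fin m → Fin n → ℚ) →
  LinIndep x → (∀ k → InEigenspace M η (x k)) →
  ∃ λ (z : Fin m → Vecℤ n) → LinIndepℤ z × (∀ k → InEigenspaceℤ M η (z k))
integral-eigenbasis M η x x-indep x-eigen =
  z , linIndep-scaled D D≢0 z≡Dx x-indep , λ k → inEigenspace-scaled M η (toℚ (+ D k)) (z≡Dx k) (x-eigen k)
  where
  D : Fin _ → ℕ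
  D k = proj₁ (clear-denominators (x k))
  D≢0 : ∀ k → D k ≢ 0
  D≢0 k = proj₁ (proj₂ (clear-denominators (x k)))
  z : Fin _ → Vecℤ _
  z k = proj₁ (proj₂ (proj₂ (clear-denominators (x k))))
  z≡Dx : ∀ k u → toℚ (z k u) ≡ toℚ (+ D k) ℚ.* x k u
  z≡Dx k = proj₂ (proj₂ (proj₂ (clear-denominators (x k))))

lemma2p2 : ∀ {n : ℕ} (G : Graph n) → Connected G →
    (p : ℕ) → Prime p →
    (s : Fin n → ℕ) → IsSmithNormalForm (laplacian G) s →
    (η : ℤ) (m : ℕ) → 1 ≤ m → HasMultiplicity (laplacian G) η m →
    (∀ (i : ℕ) → (+ (p ^ i)) ∣ η → m ≤ 1 + eSumFrom p s i)
    × (∀ (i : ℕ) → (+ (p ^ i)) ∣ η → ¬ ((+ (p ^ suc i)) ∣ η) → m ≤ eSumUpTo p s i)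
lemma2p2 G connected p p-prime s (_ , U , V , (U⁻¹ , _ , U⁻¹U≡I) , (V⁻¹ , VV⁻¹≡I , V⁻¹V≡I) , ULV≡diag)
         η m _ ((x , x-indep , x-eigen) , _) = part₁ , part₂
  where
  L : Matℤ _
  L = laplacian G
  open SmithForm L s U V U⁻¹ V⁻¹ ULV≡diag VV⁻¹≡I V⁻¹V≡I U⁻¹U≡I

  integral : ∃ λ (z : Fin m → Vecℤ _) → LinIndepℤ z × (∀ k → InEigenspaceℤ L η (z k))
  integral = integral-eigenbasis L η x x-indep x-eigen

  m≤count : ∀ β S → InjectiveOnEigenspace L η β S → m ≤ count S
  m≤count β S injective =
    linIndep-eigen-≤ L β η S injective (proj₁ integral) (proj₁ (proj₂ integral)) (proj₂ (proj₂ integral))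

  part₁ : ∀ i → + (p ^ i) ∣ η → m ≤ 1 + eSumFrom p s i
  part₁ i pⁱ∣η = ℕₚ.≤-trans (m≤count V⁻¹ _ (injective-V⁻¹ p-prime i η pⁱ∣η))
    (ℕₚ.≤-trans (count-divisible-≤ p-prime s i)
      (ℕₚ.+-monoˡ-≤ (eSumFrom p s i) (at-most-one-zero-factor (laplacian-kernel-constant G connected))))

  part₂ : ∀ i → + (p ^ i) ∣ η → ¬ (+ (p ^ suc i) ∣ η) → m ≤ eSumUpTo p s i
  -- The bound only needs p^(i+1) ∤ η.
  part₂ i _ pⁱ⁺¹∤η = ℕₚ.≤-trans (m≤count U _ (injective-U p-prime i η pⁱ⁺¹∤η)) (count-not-divisible-≤ p-prime s i)
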